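{- Let $n\ge1$ and let $p$ be a prime number with $p\equiv(-1)^n \pmod 9$. Then there is a monic polynomial $f\in\mathbb Z[X]$ of the form \[ f(X)=(X-1)^n+\sum_{k=1}^n 9^k b_k (X-1)^{n-k},\qquad b_k\in\mathbb Z, \] with $f(0)=p$ that is Eisenstein for $p$. Moreover, if $\alpha$ is a zero of $f$, then $\tfrac19(\alpha-1)$ is an algebraic integer.
   Context: A monic polynomial $X^n+a_1X^{n-1}+\dots+a_n\in\mathbb Z[X]$ is Eisenstein for $p$ if $p\mid a_k$ for all $k=1,\dots,n$ and $p^2\nmid a_n$. -}

module Defs where

open import Level using (Level)
open import Data.Nat using (ℕ; zero; suc; _∸_; _<_; _>_)
open import Data.Fin using (Fin; toℕ)
import Data.Fin as Fin
open import Data.Integer using (ℤ; +_; -[1+_]; _+_; _*_; -_; _^_; _-_)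
open import Data.Integer.Divisibility using (_∣_)
open import Data.List using (List; []; _∷_)
open import Data.Product using (_×_; Σ; ∃)
open import Relation.Nullary using (¬_)
open import Relation.Binary.PropositionalEquality using (_≡_)
open import Algebra.Bundles using (CommutativeRing)

-- Polynomials over ℤ as coefficient lists, lowest degree first.
Poly : Set
Poly = List ℤ

coeff : Poly → ℕ → ℤ
coeff []       _       = + 0
coeff (a ∷ f)  zero    = a
coeff (a ∷ f)  (suc i) = coeff f i

_+P_ : Poly → Poly → Poly
[]      +P g       = g
(a ∷ f) +P []      = a ∷ f
(a ∷ f) +P (b ∷ g) = (a + b) ∷ (f +P g)

scaleP : ℤ → Poly → Poly
scaleP c []      = []
scaleP c (a ∷ f) = (c * a) ∷ scaleP c f

_*P_ : Poly → Poly → Poly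
[]      *P g = []
(a ∷ f) *P g = scaleP a g +P (+ 0 ∷ (f *P g))

_^P_ : Poly → ℕ → Poly
f ^P zero  = + 1 ∷ []
f ^P suc k = f *P (f ^P k)

X-1 : Poly
X-1 = -[1+ 0 ] ∷ + 1 ∷ []

ΣP : (m : ℕ) → (Fin m → Poly) → Poly
ΣP zero    g = []
ΣP (suc m) g = g Fin.zero +P ΣP m (λ i → g (Fin.suc i))

-- f(X) = (X-1)^n + Σ_{k=1}^n 9^k b_k (X-1)^(n-k),   with b_k = b (k-1)
fPoly : (n : ℕ) → (Fin n → ℤ) → Poly
fPoly n b = (X-1 ^P n) +P
  ΣP n (λ i → scaleP (((+ 9) ^ suc (toℕ i)) * b i) (X-1 ^P (n ∸ suc (toℕ i))))

MonicDeg : ℕ → Poly → Set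
MonicDeg n f = coeff f n ≡ + 1 × (∀ i → i > n → coeff f i ≡ + 0)

-- f = X^n + a_1 X^(n-1) + ... + a_n monic of degree n is Eisenstein for p:
-- p ∣ a_k (k = 1..n, i.e. coefficients of X^i for i < n) and p² ∤ a_n
IsEisenstein : ℤ → ℕ → Poly → Set
IsEisenstein p n f =
  MonicDeg n f × (∀ i → i < n → p ∣ coeff f i) × ¬ ((p * p) ∣ coeff f 0)

module _ {c ℓ : Level} (R : CommutativeRing c ℓ) where
  open CommutativeRing R renaming (_+_ to _+R_; _*_ to _*R_; -_ to -R_)

  ℕ→R : ℕ → Carrier
  ℕ→R zero    = 0#
  ℕ→R (suc k) = 1# +R ℕ→R k

  ℤ→R : ℤ → Carrier
  ℤ→R (+ k)     = ℕ→R k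
  ℤ→R -[1+ k ]  = -R (ℕ→R (suc k))

  evalR : Poly → Carrier → Carrier
  evalR []      x = 0#
  evalR (a ∷ f) x = ℤ→R a +R (x *R evalR f x)

  IsAlgebraicInteger : Carrier → Set ℓ
  IsAlgebraicInteger β = Σ ℕ λ d → Σ Poly λ g → MonicDeg d g × evalR g β ≈ 0#

  -- 9 is not a zero divisor in R (so that "(α-1)/9" is well defined)
  NineCancellable : Set (c Level.⊔ ℓ)
  NineCancellable = ∀ x → ℕ→R 9 *R x ≈ 0# → x ≈ 0#

{-# OPTIONS --safe #-}
-- Write Y = X - 1, s = (-1) ^ n and r = s p, so that r ≡ 1 (mod 9) and p ∣ r, and take
-- f = (X - r) ^ n + 9 D Y ^ (n - 1) with 9 D = s p (r ^ (n - 1) - 1). Every non-leading coefficient of f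
-- is divisible by p because p ∣ r and p ∣ D, and f(0) = (-r) ^ n - p (r ^ (n - 1) - 1) = p.
-- As X - r = Y + 9 e with 9 e = 1 - r, the binomial theorem puts f in the required form with
-- b_k = C(n, k) e ^ k (plus D for k = 1). Finally f(1 + 9 y) = 9 ^ n g(y) for the monic
-- g = Y ^ n + Σ b_k Y ^ (n - k), so when 9 is cancellable (α - 1) / 9 is a root of g.
module Submission where

open import Defs
open import Level using (0ℓ)
open import Data.Nat using (ℕ; _≥_)
open import Data.Nat.Primality using (Prime)
open import Data.Fin using (Fin)
open import Data.Integer using (ℤ; +_; -[1+_]; _-_; _^_)
open import Data.Integer.Divisibility using (_∣_)
open import Data.Product using (_×_; Σ)
open import Relation.Binary.PropositionalEquality using (_≡_)
open import Algebra.Bundles using (CommutativeRing)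

open import Data.Nat as ℕ using (zero; suc; _∸_; _<_; _≤_; s≤s; z≤n)
import Data.Nat.Properties as ℕ
import Data.Fin as Fin
open import Data.Fin using (toℕ)
open import Data.Fin.Properties using (toℕ<n; toℕ≤pred[n]; toℕ-inject₁; toℕ-fromℕ)
open import Data.List using ([]; _∷_)
open import Function using (_∘_)
open import Data.Product using (_,_)
import Relation.Binary.PropositionalEquality as ≡

-- X + a, so that X-1 is lin -[1+ 0 ] definitionally
lin : ℤ → Poly
lin a = a ∷ + 1 ∷ []

-- fPoly n b is definitionally expansion X-1 n (λ i → 9 ^ (i + 1) * b i)
expansion : Poly → (n : ℕ) → (Fin n → ℤ) → Poly
expansion u n c = (u ^P n) +P ΣP n (λ i → scaleP (c i) (u ^P (n ∸ suc (toℕ i))))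

module Evaluation {c ℓ} (R : CommutativeRing c ℓ) where
  open CommutativeRing R
  open import Algebra.Properties.Ring ring using (-0#≈0#; -‿involutive; -‿distribˡ-*; -‿distribʳ-*)
  open import Algebra.Properties.AbelianGroup +-abelianGroup using (⁻¹-∙-comm)
  open import Algebra.Properties.CommutativeSemigroup +-commutativeSemigroup using (interchange)
  open import Algebra.Properties.CommutativeSemigroup *-commutativeSemigroup
    using (x∙yz≈y∙xz) renaming (interchange to *-interchange)
  open import Algebra.Properties.CommutativeSemiring.Exp commutativeSemiring
    using (^-congˡ; ^-homo-*; ^-distrib-*) renaming (_^_ to _^ᴿ_)
  open import Algebra.Properties.Semiring.Sum semiring using (sum; sum-cong-≋; *-distribˡ-sum)
  open import Relation.Binary.Reasoning.Setoid setoid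
  import Data.Integer as ℤ
  import Data.Integer.Properties as ℤ

  ℕ→R-+ : ∀ m n → ℕ→R R (m ℕ.+ n) ≈ ℕ→R R m + ℕ→R R n
  ℕ→R-+ zero    n = sym (+-identityˡ _)
  ℕ→R-+ (suc m) n = trans (+-congˡ (ℕ→R-+ m n)) (sym (+-assoc _ _ _))

  ℕ→R-* : ∀ m n → ℕ→R R (m ℕ.* n) ≈ ℕ→R R m * ℕ→R R n
  ℕ→R-* zero    n = sym (zeroˡ _)
  ℕ→R-* (suc m) n = begin
    ℕ→R R (n ℕ.+ m ℕ.* n)                  ≈⟨ ℕ→R-+ n (m ℕ.* n) ⟩
    ℕ→R R n + ℕ→R R (m ℕ.* n)              ≈⟨ +-cong (sym (*-identityˡ _)) (ℕ→R-* m n) ⟩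
    1# * ℕ→R R n + ℕ→R R m * ℕ→R R n       ≈⟨ sym (distribʳ _ _ _) ⟩
    (1# + ℕ→R R m) * ℕ→R R n               ∎

  ℤ→R-⊖ : ∀ m n → ℤ→R R (m ℤ.⊖ n) ≈ ℕ→R R m + - ℕ→R R n
  ℤ→R-⊖ m       zero    = begin
    ℤ→R R (m ℤ.⊖ 0)      ≈⟨ reflexive (≡.cong (ℤ→R R) (ℤ.⊖-≥ {m} {0} z≤n)) ⟩
    ℕ→R R m              ≈⟨ sym (+-identityʳ _) ⟩
    ℕ→R R m + 0#         ≈⟨ +-congˡ (sym -0#≈0#) ⟩
    ℕ→R R m + - 0#       ∎
  ℤ→R-⊖ zero    (suc n) = begin
    ℤ→R R (0 ℤ.⊖ suc n)  ≈⟨ reflexive (≡.cong (ℤ→R R) (ℤ.⊖-< {0} {suc n} (s≤s z≤n))) ⟩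
    - ℕ→R R (suc n)      ≈⟨ sym (+-identityˡ _) ⟩
    0# + - ℕ→R R (suc n) ∎
  ℤ→R-⊖ (suc m) (suc n) = begin
    ℤ→R R (suc m ℤ.⊖ suc n)            ≈⟨ reflexive (≡.cong (ℤ→R R) (ℤ.[1+m]⊖[1+n]≡m⊖n m n)) ⟩
    ℤ→R R (m ℤ.⊖ n)                    ≈⟨ ℤ→R-⊖ m n ⟩
    ℕ→R R m + - ℕ→R R n                ≈⟨ sym (+-identityˡ _) ⟩
    0# + (ℕ→R R m + - ℕ→R R n)         ≈⟨ +-congʳ (sym (-‿inverseʳ 1#)) ⟩
    (1# + - 1#) + (ℕ→R R m + - ℕ→R R n) ≈⟨ interchange _ _ _ _ ⟩
    (1# + ℕ→R R m) + (- 1# + - ℕ→R R n) ≈⟨ +-congˡ (⁻¹-∙-comm _ _) ⟩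
    (1# + ℕ→R R m) + - (1# + ℕ→R R n)   ∎

  ℤ→R-+ : ∀ i j → ℤ→R R (i ℤ.+ j) ≈ ℤ→R R i + ℤ→R R j
  ℤ→R-+ (+ m)    (+ n)    = ℕ→R-+ m n
  ℤ→R-+ (+ m)    -[1+ n ] = ℤ→R-⊖ m (suc n)
  ℤ→R-+ -[1+ m ] (+ n)    = trans (ℤ→R-⊖ n (suc m)) (+-comm _ _)
  ℤ→R-+ -[1+ m ] -[1+ n ] = begin
    - ℕ→R R (suc (suc (m ℕ.+ n)))        ≈⟨ -‿cong (reflexive (≡.cong (ℕ→R R ∘ suc) (≡.sym (ℕ.+-suc m n)))) ⟩
    - ℕ→R R (suc m ℕ.+ suc n)            ≈⟨ -‿cong (ℕ→R-+ (suc m) (suc n)) ⟩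
    - (ℕ→R R (suc m) + ℕ→R R (suc n))    ≈⟨ sym (⁻¹-∙-comm _ _) ⟩
    - ℕ→R R (suc m) + - ℕ→R R (suc n)    ∎

  ℤ→R-neg : ∀ i → ℤ→R R (ℤ.- i) ≈ - ℤ→R R i
  ℤ→R-neg (+ zero)  = sym -0#≈0#
  ℤ→R-neg (+ suc n) = refl
  ℤ→R-neg -[1+ n ]  = sym (-‿involutive _)

  ℤ→R-+* : ∀ m j → ℤ→R R (+ m ℤ.* j) ≈ ℕ→R R m * ℤ→R R j
  ℤ→R-+* m (+ n)    = trans (reflexive (≡.cong (ℤ→R R) (≡.sym (ℤ.pos-* m n)))) (ℕ→R-* m n)
  ℤ→R-+* m -[1+ n ] = begin
    ℤ→R R (+ m ℤ.* ℤ.- + suc n)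
      ≈⟨ reflexive (≡.cong (ℤ→R R) (≡.sym (ℤ.neg-distribʳ-* (+ m) (+ suc n)))) ⟩
    ℤ→R R (ℤ.- (+ m ℤ.* + suc n))  ≈⟨ ℤ→R-neg (+ m ℤ.* + suc n) ⟩
    - ℤ→R R (+ m ℤ.* + suc n)      ≈⟨ -‿cong (ℤ→R-+* m (+ suc n)) ⟩
    - (ℕ→R R m * ℕ→R R (suc n))    ≈⟨ -‿distribʳ-* _ _ ⟩
    ℕ→R R m * - ℕ→R R (suc n)      ∎

  ℤ→R-* : ∀ i j → ℤ→R R (i ℤ.* j) ≈ ℤ→R R i * ℤ→R R j
  ℤ→R-* (+ m)    j = ℤ→R-+* m j
  ℤ→R-* -[1+ m ] j = begin
    ℤ→R R (ℤ.- + suc m ℤ.* j)      ≈⟨ reflexive (≡.cong (ℤ→R R) (≡.sym (ℤ.neg-distribˡ-* (+ suc m) j))) ⟩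
    ℤ→R R (ℤ.- (+ suc m ℤ.* j))    ≈⟨ ℤ→R-neg (+ suc m ℤ.* j) ⟩
    - ℤ→R R (+ suc m ℤ.* j)        ≈⟨ -‿cong (ℤ→R-+* (suc m) j) ⟩
    - (ℕ→R R (suc m) * ℤ→R R j)    ≈⟨ -‿distribˡ-* _ _ ⟩
    - ℕ→R R (suc m) * ℤ→R R j      ∎

  ℤ→R-1 : ℤ→R R (+ 1) ≈ 1#
  ℤ→R-1 = +-identityʳ 1#

  ℤ→R-^ : ∀ i k → ℤ→R R (i ^ k) ≈ ℤ→R R i ^ᴿ k
  ℤ→R-^ i zero    = ℤ→R-1
  ℤ→R-^ i (suc k) = trans (ℤ→R-* i (i ^ k)) (*-congˡ (ℤ→R-^ i k))

  evalR-+P : ∀ f g x → evalR R (f +P g) x ≈ evalR R f x + evalR R g x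
  evalR-+P []      g       x = sym (+-identityˡ _)
  evalR-+P (a ∷ f) []      x = sym (+-identityʳ _)
  evalR-+P (a ∷ f) (b ∷ g) x = begin
    ℤ→R R (a ℤ.+ b) + x * evalR R (f +P g) x
      ≈⟨ +-cong (ℤ→R-+ a b) (trans (*-congˡ (evalR-+P f g x)) (distribˡ _ _ _)) ⟩
    (ℤ→R R a + ℤ→R R b) + (x * evalR R f x + x * evalR R g x)
      ≈⟨ interchange _ _ _ _ ⟩
    (ℤ→R R a + x * evalR R f x) + (ℤ→R R b + x * evalR R g x) ∎

  evalR-scaleP : ∀ a f x → evalR R (scaleP a f) x ≈ ℤ→R R a * evalR R f x
  evalR-scaleP a []      x = sym (zeroʳ _)
  evalR-scaleP a (b ∷ f) x = begin
    ℤ→R R (a ℤ.* b) + x * evalR R (scaleP a f) x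
      ≈⟨ +-cong (ℤ→R-* a b) (*-congˡ (evalR-scaleP a f x)) ⟩
    ℤ→R R a * ℤ→R R b + x * (ℤ→R R a * evalR R f x)
      ≈⟨ +-congˡ (x∙yz≈y∙xz x (ℤ→R R a) (evalR R f x)) ⟩
    ℤ→R R a * ℤ→R R b + ℤ→R R a * (x * evalR R f x)
      ≈⟨ sym (distribˡ _ _ _) ⟩
    ℤ→R R a * (ℤ→R R b + x * evalR R f x) ∎

  evalR-*P : ∀ f g x → evalR R (f *P g) x ≈ evalR R f x * evalR R g x
  evalR-*P []      g x = sym (zeroˡ _)
  evalR-*P (a ∷ f) g x = begin
    evalR R (scaleP a g +P (+ 0 ∷ (f *P g))) x
      ≈⟨ evalR-+P (scaleP a g) (+ 0 ∷ (f *P g)) x ⟩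
    evalR R (scaleP a g) x + (0# + x * evalR R (f *P g) x)
      ≈⟨ +-cong (evalR-scaleP a g x) (trans (+-identityˡ _) (*-congˡ (evalR-*P f g x))) ⟩
    ℤ→R R a * evalR R g x + x * (evalR R f x * evalR R g x)
      ≈⟨ +-congˡ (sym (*-assoc _ _ _)) ⟩
    ℤ→R R a * evalR R g x + (x * evalR R f x) * evalR R g x
      ≈⟨ sym (distribʳ _ _ _) ⟩
    (ℤ→R R a + x * evalR R f x) * evalR R g x ∎

  evalR-one : ∀ x → evalR R (+ 1 ∷ []) x ≈ 1#
  evalR-one x = trans (+-cong ℤ→R-1 (zeroʳ x)) (+-identityʳ 1#)

  evalR-^P : ∀ f n x → evalR R (f ^P n) x ≈ evalR R f x ^ᴿ n
  evalR-^P f zero    x = evalR-one x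
  evalR-^P f (suc n) x = trans (evalR-*P f (f ^P n) x) (*-congˡ (evalR-^P f n x))

  evalR-ΣP : ∀ m g x → evalR R (ΣP m g) x ≈ sum (λ i → evalR R (g i) x)
  evalR-ΣP zero    g x = refl
  evalR-ΣP (suc m) g x = trans (evalR-+P (g Fin.zero) _ x) (+-congˡ (evalR-ΣP m (λ i → g (Fin.suc i)) x))

  evalR-lin : ∀ a x → evalR R (lin a) x ≈ ℤ→R R a + x
  evalR-lin a x = +-congˡ (trans (*-congˡ (evalR-one x)) (*-identityʳ x))

  expansionValue : (n : ℕ) → (Fin n → Carrier) → Carrier → Carrier
  expansionValue n d y = y ^ᴿ n + sum (λ i → d i * y ^ᴿ (n ∸ suc (toℕ i)))

  evalR-expansion : ∀ u n c x →
    evalR R (expansion u n c) x ≈ expansionValue n (λ i → ℤ→R R (c i)) (evalR R u x)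
  evalR-expansion u n c x = trans (evalR-+P (u ^P n) _ x) (+-cong (evalR-^P u n x)
    (trans (evalR-ΣP n _ x) (sum-cong-≋ (λ i → trans (evalR-scaleP (c i) (u ^P (n ∸ suc (toℕ i))) x)
      (*-congˡ (evalR-^P u (n ∸ suc (toℕ i)) x))))))

  expansionValue-cong : ∀ n {d d′ y y′} → (∀ i → d i ≈ d′ i) → y ≈ y′ →
    expansionValue n d y ≈ expansionValue n d′ y′
  expansionValue-cong n d≈d′ y≈y′ = +-cong (^-congˡ n y≈y′)
    (sum-cong-≋ (λ i → *-cong (d≈d′ i) (^-congˡ (n ∸ suc (toℕ i)) y≈y′)))

  -- the weights l ^ (i + 1) are exactly what makes every term homogeneous of degree n in l
  expansionValue-rescale : ∀ n l y d →
    expansionValue n (λ i → l ^ᴿ suc (toℕ i) * d i) (l * y) ≈ l ^ᴿ n * expansionValue n d y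
  expansionValue-rescale n l y d = begin
    (l * y) ^ᴿ n + sum (λ i → (l ^ᴿ suc (toℕ i) * d i) * (l * y) ^ᴿ (n ∸ suc (toℕ i)))
      ≈⟨ +-cong (^-distrib-* l y n) (sum-cong-≋ homogeneous) ⟩
    l ^ᴿ n * y ^ᴿ n + sum (λ i → l ^ᴿ n * (d i * y ^ᴿ (n ∸ suc (toℕ i))))
      ≈⟨ +-congˡ (sym (*-distribˡ-sum (l ^ᴿ n) (λ i → d i * y ^ᴿ (n ∸ suc (toℕ i))))) ⟩
    l ^ᴿ n * y ^ᴿ n + l ^ᴿ n * sum (λ i → d i * y ^ᴿ (n ∸ suc (toℕ i)))
      ≈⟨ sym (distribˡ _ _ _) ⟩
    l ^ᴿ n * expansionValue n d y ∎
    where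
    homogeneous : ∀ i → (l ^ᴿ suc (toℕ i) * d i) * (l * y) ^ᴿ (n ∸ suc (toℕ i))
                      ≈ l ^ᴿ n * (d i * y ^ᴿ (n ∸ suc (toℕ i)))
    homogeneous i = begin
      (l ^ᴿ suc k * d i) * (l * y) ^ᴿ (n ∸ suc k)
        ≈⟨ *-congˡ (^-distrib-* l y (n ∸ suc k)) ⟩
      (l ^ᴿ suc k * d i) * (l ^ᴿ (n ∸ suc k) * y ^ᴿ (n ∸ suc k))
        ≈⟨ *-interchange _ _ _ _ ⟩
      (l ^ᴿ suc k * l ^ᴿ (n ∸ suc k)) * (d i * y ^ᴿ (n ∸ suc k))
        ≈⟨ *-congʳ (sym (^-homo-* l (suc k) (n ∸ suc k))) ⟩
      l ^ᴿ (suc k ℕ.+ (n ∸ suc k)) * (d i * y ^ᴿ (n ∸ suc k))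
        ≈⟨ *-congʳ (reflexive (≡.cong (l ^ᴿ_) (ℕ.m+[n∸m]≡n (toℕ<n i)))) ⟩
      l ^ᴿ n * (d i * y ^ᴿ (n ∸ suc k)) ∎
      where k = toℕ i

  ^-cancel : ∀ {a} → (∀ x → a * x ≈ 0# → x ≈ 0#) → ∀ n z → a ^ᴿ n * z ≈ 0# → z ≈ 0#
  ^-cancel a-cancel zero    z 1z≈0   = trans (sym (*-identityˡ z)) 1z≈0
  ^-cancel a-cancel (suc n) z aaⁿz≈0 = ^-cancel a-cancel n z (a-cancel _ (trans (sym (*-assoc _ _ _)) aaⁿz≈0))

  fPoly-at-1+9y : ∀ n b y →
    evalR R (fPoly n b) (1# + ℕ→R R 9 * y) ≈ ℕ→R R 9 ^ᴿ n * evalR R (expansion (lin (+ 0)) n b) y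
  fPoly-at-1+9y n b y = begin
    evalR R (fPoly n b) (1# + nine * y)
      ≈⟨ evalR-expansion X-1 n (λ i → (+ 9) ^ suc (toℕ i) ℤ.* b i) (1# + nine * y) ⟩
    expansionValue n (λ i → ℤ→R R ((+ 9) ^ suc (toℕ i) ℤ.* b i)) (evalR R X-1 (1# + nine * y))
      ≈⟨ expansionValue-cong n (λ i → trans (ℤ→R-* ((+ 9) ^ suc (toℕ i)) (b i)) (*-congʳ (ℤ→R-^ (+ 9) (suc (toℕ i)))))
           X-1-at-1+9y ⟩
    expansionValue n (λ i → nine ^ᴿ suc (toℕ i) * ℤ→R R (b i)) (nine * y)
      ≈⟨ expansionValue-rescale n nine y (λ i → ℤ→R R (b i)) ⟩
    nine ^ᴿ n * expansionValue n (λ i → ℤ→R R (b i)) y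
      ≈⟨ *-congˡ (sym (trans (evalR-expansion (lin (+ 0)) n b y) (expansionValue-cong n (λ _ → refl) X-at-y))) ⟩
    nine ^ᴿ n * evalR R (expansion (lin (+ 0)) n b) y ∎
    where
    nine = ℕ→R R 9
    X-1-at-1+9y : evalR R X-1 (1# + nine * y) ≈ nine * y
    X-1-at-1+9y = begin
      evalR R X-1 (1# + nine * y)       ≈⟨ evalR-lin -[1+ 0 ] (1# + nine * y) ⟩
      - (1# + 0#) + (1# + nine * y)     ≈⟨ +-congʳ (-‿cong (+-identityʳ 1#)) ⟩
      - 1# + (1# + nine * y)            ≈⟨ sym (+-assoc _ _ _) ⟩
      (- 1# + 1#) + nine * y            ≈⟨ +-congʳ (-‿inverseˡ 1#) ⟩
      0# + nine * y                     ≈⟨ +-identityˡ _ ⟩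
      nine * y ∎
    X-at-y : evalR R (lin (+ 0)) y ≈ y
    X-at-y = trans (evalR-lin (+ 0) y) (+-identityˡ y)

open import Data.Nat.Combinatorics using (_C_; k>n⇒nCk≡0; nCk+nC[k+1]≡[n+1]C[k+1])
open import Data.Integer using (_+_; _*_; -_)
open import Data.Integer.Properties
open import Data.Integer.Divisibility.Signed as Signed
  using (divides; ∣-refl; ∣m∣n⇒∣m+n; ∣n⇒∣m*n; ∣m⇒∣m*n; ∣m⇒∣-m)
open import Data.Integer.Tactic.RingSolver using (solve-∀)
open import Algebra.Properties.Semiring.Sum +-*-semiring
  using (sum; sum-syntax; sum⁺-syntax; sum-cong-≗; sum-init-last; sum-replicate-zero; ∑-distrib-+; *-distribˡ-sum)
open import Relation.Binary.PropositionalEquality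
  using (refl; sym; trans; cong; cong₂; subst; module ≡-Reasoning)
open import Relation.Nullary using (¬_)
open import Data.Nat.Primality using (¬prime[1]; prime⇒nonZero)
import Data.Nat.Divisibility as ℕ∣

coeff-+P : ∀ f g i → coeff (f +P g) i ≡ coeff f i + coeff g i
coeff-+P []      g       i       = sym (+-identityˡ _)
coeff-+P (a ∷ f) []      i       = sym (+-identityʳ _)
coeff-+P (a ∷ f) (b ∷ g) zero    = refl
coeff-+P (a ∷ f) (b ∷ g) (suc i) = coeff-+P f g i

coeff-scaleP : ∀ c f i → coeff (scaleP c f) i ≡ c * coeff f i
coeff-scaleP c []      i       = sym (*-zeroʳ c)
coeff-scaleP c (a ∷ f) zero    = refl
coeff-scaleP c (a ∷ f) (suc i) = coeff-scaleP c f i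

coeff-ΣP : ∀ m g i → coeff (ΣP m g) i ≡ sum (λ k → coeff (g k) i)
coeff-ΣP zero    g i = refl
coeff-ΣP (suc m) g i =
  trans (coeff-+P (g Fin.zero) _ i) (cong (_+_ (coeff (g Fin.zero) i)) (coeff-ΣP m (λ k → g (Fin.suc k)) i))

coeff-lin-*P : ∀ a h i → coeff (lin a *P h) i ≡ a * coeff h i + coeff (+ 0 ∷ h) i
coeff-lin-*P a h i = trans (coeff-+P (scaleP a h) _ i) (cong₂ _+_ (coeff-scaleP a h i) (X*h i))
  where
  X*h : ∀ i → coeff (+ 0 ∷ (scaleP (+ 1) h +P (+ 0 ∷ []))) i ≡ coeff (+ 0 ∷ h) i
  X*h zero    = refl
  X*h (suc i) = trans (coeff-+P (scaleP (+ 1) h) _ i)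
    (trans (cong₂ _+_ (trans (coeff-scaleP (+ 1) h i) (*-identityˡ _)) (zero-list i)) (+-identityʳ _))
    where
    zero-list : ∀ i → coeff (+ 0 ∷ []) i ≡ + 0
    zero-list zero    = refl
    zero-list (suc i) = refl

coeff-lin-^P-zero : ∀ a m → coeff (lin a ^P m) 0 ≡ a ^ m
coeff-lin-^P-zero a zero    = refl
coeff-lin-^P-zero a (suc m) =
  trans (coeff-lin-*P a (lin a ^P m) 0) (trans (+-identityʳ _) (cong (a *_) (coeff-lin-^P-zero a m)))

coeff-lin-^P-above : ∀ a m i → m < i → coeff (lin a ^P m) i ≡ + 0
coeff-lin-^P-above a zero    (suc i) _         = refl
coeff-lin-^P-above a (suc m) (suc i) (s≤s m<i) = begin
  coeff (lin a ^P suc m) (suc i)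
    ≡⟨ coeff-lin-*P a (lin a ^P m) (suc i) ⟩
  a * coeff (lin a ^P m) (suc i) + coeff (lin a ^P m) i
    ≡⟨ cong₂ (λ u v → a * u + v)
         (coeff-lin-^P-above a m (suc i) (ℕ.m<n⇒m<1+n m<i)) (coeff-lin-^P-above a m i m<i) ⟩
  a * + 0 + + 0
    ≡⟨ trans (+-identityʳ _) (*-zeroʳ a) ⟩
  + 0 ∎
  where open ≡-Reasoning

coeff-lin-^P-top : ∀ a m → coeff (lin a ^P m) m ≡ + 1
coeff-lin-^P-top a zero    = refl
coeff-lin-^P-top a (suc m) = begin
  coeff (lin a ^P suc m) (suc m)
    ≡⟨ coeff-lin-*P a (lin a ^P m) (suc m) ⟩
  a * coeff (lin a ^P m) (suc m) + coeff (lin a ^P m) m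
    ≡⟨ cong₂ (λ u v → a * u + v) (coeff-lin-^P-above a m (suc m) (ℕ.n<1+n m)) (coeff-lin-^P-top a m) ⟩
  a * + 0 + + 1
    ≡⟨ cong (_+ + 1) (*-zeroʳ a) ⟩
  + 1 ∎
  where open ≡-Reasoning

∣coeff-lin-^P : ∀ {d} a m i → d Signed.∣ a → i < m → d Signed.∣ coeff (lin a ^P m) i
∣coeff-lin-^P a (suc m) zero    d∣a _         =
  subst (_ Signed.∣_) (sym (trans (coeff-lin-*P a (lin a ^P m) 0) (+-identityʳ _))) (∣m⇒∣m*n _ d∣a)
∣coeff-lin-^P a (suc m) (suc i) d∣a (s≤s i<m) =
  subst (_ Signed.∣_) (sym (coeff-lin-*P a (lin a ^P m) (suc i)))
    (∣m∣n⇒∣m+n (∣m⇒∣m*n _ d∣a) (∣coeff-lin-^P a m i d∣a i<m))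

coeff-expansion : ∀ u n c j →
  coeff (expansion u n c) j ≡ coeff (u ^P n) j + sum (λ i → c i * coeff (u ^P (n ∸ suc (toℕ i))) j)
coeff-expansion u n c j = trans (coeff-+P (u ^P n) _ j) (cong (_+_ (coeff (u ^P n) j))
  (trans (coeff-ΣP n _ j) (sum-cong-≗ (λ i → coeff-scaleP (c i) (u ^P (n ∸ suc (toℕ i))) j))))

expansion-monic : ∀ a n c → MonicDeg n (expansion (lin a) n c)
expansion-monic a n c =
    trans (coeff-expansion (lin a) n c n) (cong₂ _+_ (coeff-lin-^P-top a n) (lower-terms-vanish n ℕ.≤-refl))
  , λ j n<j → trans (coeff-expansion (lin a) n c j)
      (cong₂ _+_ (coeff-lin-^P-above a n j n<j) (lower-terms-vanish j (ℕ.<⇒≤ n<j)))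
  where
  lower-terms-vanish : ∀ j → n ≤ j → sum (λ i → c i * coeff (lin a ^P (n ∸ suc (toℕ i))) j) ≡ + 0
  lower-terms-vanish j n≤j = trans (sum-cong-≗ term-vanishes) (sum-replicate-zero n)
    where
    term-vanishes : ∀ i → c i * coeff (lin a ^P (n ∸ suc (toℕ i))) j ≡ + 0
    term-vanishes i = trans (cong (c i *_) (coeff-lin-^P-above a _ j
      (ℕ.<-≤-trans (ℕ.∸-monoʳ-< (s≤s z≤n) (toℕ<n i)) n≤j))) (*-zeroʳ (c i))

binomialTerm : ℤ → ℕ → ℕ → ℤ
binomialTerm t n k = + (n C k) * t ^ k

binomialTerm-pascal : ∀ t n k →
  binomialTerm t (suc n) (suc k) ≡ binomialTerm t n (suc k) + t * binomialTerm t n k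
binomialTerm-pascal t n k = begin
  + (suc n C suc k) * (t * t ^ k)
    ≡⟨ cong (λ m → + m * (t * t ^ k)) (sym (nCk+nC[k+1]≡[n+1]C[k+1] n k)) ⟩
  + (n C k ℕ.+ n C suc k) * (t * t ^ k)
    ≡⟨ cong (_* (t * t ^ k)) (pos-+ (n C k) (n C suc k)) ⟩
  (+ (n C k) + + (n C suc k)) * (t * t ^ k)
    ≡⟨ regroup (+ (n C k)) (+ (n C suc k)) t (t ^ k) ⟩
  + (n C suc k) * (t * t ^ k) + t * (+ (n C k) * t ^ k) ∎
  where
  open ≡-Reasoning
  regroup : ∀ A B t T → (A + B) * (t * T) ≡ B * (t * T) + t * (A * T)
  regroup = solve-∀

binomialTerm-above : ∀ t n k → n < k → binomialTerm t n k ≡ + 0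
binomialTerm-above t n k n<k = cong (λ m → + m * t ^ k) (k>n⇒nCk≡0 n<k)

sum-lastℕ : ∀ n (g : ℕ → ℤ) → ∑[ k ≤ suc n ] g (toℕ k) ≡ ∑[ k ≤ n ] g (toℕ k) + g (suc n)
sum-lastℕ n g = trans (sum-init-last {suc n} (λ k → g (toℕ k)))
  (cong₂ _+_ (sum-cong-≗ {suc n} (λ k → cong g (toℕ-inject₁ k))) (cong g (toℕ-fromℕ (suc n))))

binomialTerm-sum-extend : ∀ t n (y : ℕ → ℤ) →
  ∑[ k ≤ suc n ] (binomialTerm t n (toℕ k) * y (toℕ k)) ≡ ∑[ k ≤ n ] (binomialTerm t n (toℕ k) * y (toℕ k))
binomialTerm-sum-extend t n y = begin
  ∑[ k ≤ suc n ] (binomialTerm t n (toℕ k) * y (toℕ k))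
    ≡⟨ sum-lastℕ n (λ k → binomialTerm t n k * y k) ⟩
  ∑[ k ≤ n ] (binomialTerm t n (toℕ k) * y (toℕ k)) + binomialTerm t n (suc n) * y (suc n)
    ≡⟨ cong (λ c → ∑[ k ≤ n ] (binomialTerm t n (toℕ k) * y (toℕ k)) + c * y (suc n))
         (binomialTerm-above t n (suc n) (ℕ.n<1+n n)) ⟩
  ∑[ k ≤ n ] (binomialTerm t n (toℕ k) * y (toℕ k)) + + 0 * y (suc n)
    ≡⟨ +-identityʳ _ ⟩
  ∑[ k ≤ n ] (binomialTerm t n (toℕ k) * y (toℕ k)) ∎
  where open ≡-Reasoning

binomialTerm-pascal-sum : ∀ t n (y : ℕ → ℤ) →
  ∑[ k ≤ n ] (binomialTerm t (suc n) (suc (toℕ k)) * y (toℕ k))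
    ≡ ∑[ k ≤ n ] (binomialTerm t n (suc (toℕ k)) * y (toℕ k))
      + t * ∑[ k ≤ n ] (binomialTerm t n (toℕ k) * y (toℕ k))
binomialTerm-pascal-sum t n y = begin
  ∑[ k ≤ n ] (binomialTerm t (suc n) (suc (toℕ k)) * y (toℕ k))
    ≡⟨ sum-cong-≗ {suc n} (λ k → trans (cong (_* y (toℕ k)) (binomialTerm-pascal t n (toℕ k)))
         (spread (binomialTerm t n (suc (toℕ k))) t (binomialTerm t n (toℕ k)) (y (toℕ k)))) ⟩
  ∑[ k ≤ n ] (next k + t * this k)
    ≡⟨ ∑-distrib-+ {suc n} next (λ k → t * this k) ⟩
  ∑[ k ≤ n ] next k + ∑[ k ≤ n ] (t * this k)
    ≡⟨ cong (_+_ (∑[ k ≤ n ] next k)) (sym (*-distribˡ-sum {suc n} t this)) ⟩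
  ∑[ k ≤ n ] next k + t * ∑[ k ≤ n ] this k ∎
  where
  open ≡-Reasoning
  this next : Fin (suc n) → ℤ
  this k = binomialTerm t n (toℕ k) * y (toℕ k)
  next k = binomialTerm t n (suc (toℕ k)) * y (toℕ k)
  spread : ∀ b' t b y → (b' + t * b) * y ≡ b' * y + t * (b * y)
  spread = solve-∀

coeff-shift-sum : ∀ {m} h (x : Fin m → ℤ) (g : Fin m → Poly) →
  (∀ i → coeff h i ≡ ∑[ k < m ] (x k * coeff (g k) i)) →
  ∀ j → coeff (+ 0 ∷ h) j ≡ ∑[ k < m ] (x k * coeff (+ 0 ∷ g k) j)
coeff-shift-sum {m} h x g h≡ zero    = sym (trans (sum-cong-≗ {m} (λ k → *-zeroʳ (x k))) (sum-replicate-zero m))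
coeff-shift-sum     h x g h≡ (suc j) = h≡ j

sum-coeff-lin-^P-suc : ∀ a n (x : Fin (suc n) → ℤ) j →
  ∑[ k ≤ n ] (x k * coeff (lin a ^P (suc n ∸ toℕ k)) j)
    ≡ a * ∑[ k ≤ n ] (x k * coeff (lin a ^P (n ∸ toℕ k)) j)
      + ∑[ k ≤ n ] (x k * coeff (+ 0 ∷ lin a ^P (n ∸ toℕ k)) j)
sum-coeff-lin-^P-suc a n x j = begin
  ∑[ k ≤ n ] (x k * Y (suc n ∸ toℕ k))
    ≡⟨ sum-cong-≗ {suc n} (λ k → trans
         (cong (λ m → x k * Y m) (ℕ.+-∸-assoc 1 (toℕ≤pred[n] k)))
         (trans (cong (x k *_) (coeff-lin-*P a (lin a ^P (n ∸ toℕ k)) j))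
                (spread (x k) a (Y (n ∸ toℕ k)) (X*Y (n ∸ toℕ k))))) ⟩
  ∑[ k ≤ n ] (a * (x k * Y (n ∸ toℕ k)) + x k * X*Y (n ∸ toℕ k))
    ≡⟨ ∑-distrib-+ (λ k → a * (x k * Y (n ∸ toℕ k))) (λ k → x k * X*Y (n ∸ toℕ k)) ⟩
  ∑[ k ≤ n ] (a * (x k * Y (n ∸ toℕ k))) + ∑[ k ≤ n ] (x k * X*Y (n ∸ toℕ k))
    ≡⟨ cong (_+ ∑[ k ≤ n ] (x k * X*Y (n ∸ toℕ k))) (sym (*-distribˡ-sum a (λ k → x k * Y (n ∸ toℕ k)))) ⟩
  a * ∑[ k ≤ n ] (x k * Y (n ∸ toℕ k)) + ∑[ k ≤ n ] (x k * X*Y (n ∸ toℕ k)) ∎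
  where
  open ≡-Reasoning
  Y X*Y : ℕ → ℤ
  Y m = coeff (lin a ^P m) j
  X*Y m = coeff (+ 0 ∷ lin a ^P m) j
  spread : ∀ x a y z → x * (a * y + z) ≡ a * (x * y) + x * z
  spread = solve-∀

binomial-lin : ∀ a t n j →
  coeff (lin (a + t) ^P n) j ≡ ∑[ k ≤ n ] (binomialTerm t n (toℕ k) * coeff (lin a ^P (n ∸ toℕ k)) j)
binomial-lin a t zero    j = sym (trans (+-identityʳ _) (*-identityˡ _))
binomial-lin a t (suc n) j = begin
  coeff (lin (a + t) ^P suc n) j
    ≡⟨ coeff-lin-*P (a + t) (lin (a + t) ^P n) j ⟩
  (a + t) * coeff (lin (a + t) ^P n) j + coeff (+ 0 ∷ lin (a + t) ^P n) j
    ≡⟨ cong₂ (λ u v → (a + t) * u + v) (binomial-lin a t n j)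
         (coeff-shift-sum (lin (a + t) ^P n) β (λ k → lin a ^P (n ∸ toℕ k)) (binomial-lin a t n) j) ⟩
  (a + t) * S + Z
    ≡⟨ regroup a t S Z ⟩
  (a * S + Z) + t * S
    ≡⟨ cong (_+ t * S) (sym (sum-coeff-lin-^P-suc a n β j)) ⟩
  ∑[ k ≤ n ] (β k * Y (suc n ∸ toℕ k)) + t * S
    ≡⟨ cong (_+ t * S) (sym (binomialTerm-sum-extend t n (λ k → Y (suc n ∸ k)))) ⟩
  ∑[ k ≤ suc n ] (β′ k * Y (suc n ∸ toℕ k)) + t * S
    ≡⟨ +-assoc (binomialTerm t n 0 * Y (suc n)) (∑[ k ≤ n ] (binomialTerm t n (suc (toℕ k)) * Y (n ∸ toℕ k)))
               (t * S) ⟩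
  binomialTerm t n 0 * Y (suc n) + (∑[ k ≤ n ] (binomialTerm t n (suc (toℕ k)) * Y (n ∸ toℕ k)) + t * S)
    ≡⟨ cong (_+_ (binomialTerm t n 0 * Y (suc n))) (sym (binomialTerm-pascal-sum t n (λ k → Y (n ∸ k)))) ⟩
  ∑[ k ≤ suc n ] (binomialTerm t (suc n) (toℕ k) * Y (suc n ∸ toℕ k)) ∎
  where
  open ≡-Reasoning
  Y : ℕ → ℤ
  Y m = coeff (lin a ^P m) j
  β : Fin (suc n) → ℤ
  β k = binomialTerm t n (toℕ k)
  β′ : Fin (suc (suc n)) → ℤ
  β′ k = binomialTerm t n (toℕ k)
  S Z : ℤ
  S = ∑[ k ≤ n ] (β k * Y (n ∸ toℕ k))
  Z = ∑[ k ≤ n ] (β k * coeff (+ 0 ∷ lin a ^P (n ∸ toℕ k)) j)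
  regroup : ∀ a t S Z → (a + t) * S + Z ≡ (a * S + Z) + t * S
  regroup = solve-∀

^-distrib-* : ∀ x y k → (x * y) ^ k ≡ x ^ k * y ^ k
^-distrib-* x y zero    = refl
^-distrib-* x y (suc k) = trans (cong ((x * y) *_) (^-distrib-* x y k)) (interchange x y (x ^ k) (y ^ k))
  where
  interchange : ∀ x y u v → (x * y) * (u * v) ≡ (x * u) * (y * v)
  interchange = solve-∀

binomialTerm-scale : ∀ s e n k → s ^ k * binomialTerm e n k ≡ binomialTerm (s * e) n k
binomialTerm-scale s e n k = trans (reorder (s ^ k) (+ (n C k)) (e ^ k))
  (cong (+ (n C k) *_) (sym (^-distrib-* s e k)))
  where
  reorder : ∀ S c E → S * (c * E) ≡ c * (S * E)
  reorder = solve-∀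

shiftedBinomial : (n' : ℕ) → ℤ → ℤ → Fin (suc n') → ℤ
shiftedBinomial n' e D Fin.zero    = binomialTerm e (suc n') 1 + D
shiftedBinomial n' e D (Fin.suc i) = binomialTerm e (suc n') (suc (suc (toℕ i)))

coeff-fPoly-shiftedBinomial : ∀ n' e D j →
  coeff (fPoly (suc n') (shiftedBinomial n' e D)) j
    ≡ coeff (lin (-[1+ 0 ] + + 9 * e) ^P suc n') j + + 9 * D * coeff (X-1 ^P n') j
coeff-fPoly-shiftedBinomial n' e D j = begin
  coeff (fPoly n (shiftedBinomial n' e D)) j
    ≡⟨ coeff-expansion X-1 n (λ i → (+ 9) ^ suc (toℕ i) * shiftedBinomial n' e D i) j ⟩
  Y n + (+ 9 * (binomialTerm e n 1 + D) * Y n'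
         + ∑[ i < n' ] ((+ 9) ^ suc (suc (toℕ i)) * binomialTerm e n (suc (suc (toℕ i))) * Y (n' ∸ suc (toℕ i))))
    ≡⟨ cong₂ (λ u v → Y n + (u * Y n' + v))
         (trans (*-distribˡ-+ (+ 9) (binomialTerm e n 1) D) (cong (_+ + 9 * D) (binomialTerm-scale (+ 9) e n 1)))
         (sum-cong-≗ {n'} (λ i → cong (_* Y (n' ∸ suc (toℕ i)))
                                      (binomialTerm-scale (+ 9) e n (suc (suc (toℕ i)))))) ⟩
  Y n + ((binomialTerm (+ 9 * e) n 1 + + 9 * D) * Y n' + T)
    ≡⟨ regroup (Y n) (Y n') (binomialTerm (+ 9 * e) n 1) D T ⟩
  (binomialTerm (+ 9 * e) n 0 * Y n + (binomialTerm (+ 9 * e) n 1 * Y n' + T)) + + 9 * D * Y n'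
    ≡⟨ cong (_+ + 9 * D * Y n') (sym (binomial-lin -[1+ 0 ] (+ 9 * e) n j)) ⟩
  coeff (lin (-[1+ 0 ] + + 9 * e) ^P n) j + + 9 * D * Y n' ∎
  where
  open ≡-Reasoning
  n = suc n'
  Y : ℕ → ℤ
  Y m = coeff (X-1 ^P m) j
  T : ℤ
  T = ∑[ i < n' ] (binomialTerm (+ 9 * e) n (suc (suc (toℕ i))) * Y (n' ∸ suc (toℕ i)))
  regroup : ∀ y y' B D T → y + ((B + + 9 * D) * y' + T) ≡ (+ 1 * y + (B * y' + T)) + + 9 * D * y'
  regroup = solve-∀

sign-square : ∀ k → -[1+ 0 ] ^ k * -[1+ 0 ] ^ k ≡ + 1
sign-square zero    = refl
sign-square (suc k) = trans (square-neg (-[1+ 0 ] ^ k)) (sign-square k)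
  where
  square-neg : ∀ x → (-[1+ 0 ] * x) * (-[1+ 0 ] * x) ≡ x * x
  square-neg = solve-∀

∣x-1⇒∣x^k-1 : ∀ {d x} k → d Signed.∣ x - + 1 → d Signed.∣ x ^ k - + 1
∣x-1⇒∣x^k-1 {d} zero    _     = divides (+ 0) (sym (*-zeroˡ d))
∣x-1⇒∣x^k-1 {d} {x} (suc k) d∣x-1 =
  subst (d Signed.∣_) (telescope x (x ^ k)) (∣m∣n⇒∣m+n (∣n⇒∣m*n x (∣x-1⇒∣x^k-1 k d∣x-1)) d∣x-1)
  where
  telescope : ∀ x X → x * (X - + 1) + (x - + 1) ≡ x * X - + 1
  telescope = solve-∀

eisensteinParameters : ∀ n' p → + 9 Signed.∣ + p - -[1+ 0 ] ^ suc n' →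
  Σ ℤ λ e → Σ ℤ λ D →
    + p Signed.∣ -[1+ 0 ] + + 9 * e × + p Signed.∣ D
    × (-[1+ 0 ] + + 9 * e) ^ suc n' + + 9 * D * -[1+ 0 ] ^ n' ≡ + p
eisensteinParameters n' p 9∣p-s =
  - q , s * + p * m , p∣root , ∣m⇒∣m*n m (∣n⇒∣m*n s ∣-refl) , constant-term
  where
  open ≡-Reasoning
  σ s r : ℤ
  σ = -[1+ 0 ] ^ n'
  s = -[1+ 0 ] ^ suc n'
  r = s * + p
  9∣r-1 : + 9 Signed.∣ r - + 1
  9∣r-1 = subst (+ 9 Signed.∣_)
    (trans (*-distribˡ-+ s (+ p) (- s))
           (cong (λ u → r + u) (trans (sym (neg-distribʳ-* s s)) (cong -_ (sign-square (suc n'))))))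
    (∣n⇒∣m*n s 9∣p-s)
  9∣R-1 : + 9 Signed.∣ r ^ n' - + 1
  9∣R-1 = ∣x-1⇒∣x^k-1 n' 9∣r-1
  q m : ℤ
  q = Signed.quotient 9∣r-1
  m = Signed.quotient 9∣R-1
  root≡-r : -[1+ 0 ] + + 9 * - q ≡ - r
  root≡-r = begin
    -[1+ 0 ] + + 9 * - q        ≡⟨ solve₁ q ⟩
    -[1+ 0 ] - q * + 9          ≡⟨ cong (_-_ -[1+ 0 ]) (sym (Signed._∣_.equality 9∣r-1)) ⟩
    -[1+ 0 ] - (r - + 1)        ≡⟨ solve₂ r ⟩
    - r ∎
    where
    solve₁ : ∀ q → -[1+ 0 ] + + 9 * - q ≡ -[1+ 0 ] - q * + 9
    solve₁ = solve-∀
    solve₂ : ∀ r → -[1+ 0 ] - (r - + 1) ≡ - r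
    solve₂ = solve-∀
  p∣root : + p Signed.∣ -[1+ 0 ] + + 9 * - q
  p∣root = subst (+ p Signed.∣_) (sym root≡-r) (∣m⇒∣-m (∣n⇒∣m*n s ∣-refl))
  constant-term : (-[1+ 0 ] + + 9 * - q) ^ suc n' + + 9 * (s * + p * m) * σ ≡ + p
  constant-term = begin
    (-[1+ 0 ] + + 9 * - q) ^ suc n' + + 9 * (s * + p * m) * σ
      ≡⟨ cong (λ u → u ^ suc n' + + 9 * (s * + p * m) * σ) root≡-r ⟩
    (- r) ^ suc n' + + 9 * (s * + p * m) * σ
      ≡⟨ cong (_+ + 9 * (s * + p * m) * σ)
              (trans (cong (_^ suc n') (sym (-1*i≡-i r))) (^-distrib-* -[1+ 0 ] r (suc n'))) ⟩
    s * (r * r ^ n') + + 9 * (s * + p * m) * σ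
      ≡⟨ expand σ (+ p) (r ^ n') m ⟩
    (σ * σ) * (+ p * r ^ n' - + p * (m * + 9))
      ≡⟨ cong₂ (λ u v → u * (+ p * r ^ n' - + p * v)) (sign-square n') (sym (Signed._∣_.equality 9∣R-1)) ⟩
    + 1 * (+ p * r ^ n' - + p * (r ^ n' - + 1))
      ≡⟨ collapse (+ p) (r ^ n') ⟩
    + p ∎
    where
    expand : ∀ σ p R m → (-[1+ 0 ] * σ) * (((-[1+ 0 ] * σ) * p) * R) + + 9 * ((-[1+ 0 ] * σ) * p * m) * σ
                       ≡ (σ * σ) * (p * R - p * (m * + 9))
    expand = solve-∀
    collapse : ∀ p R → + 1 * (p * R - p * (R - + 1)) ≡ p
    collapse = solve-∀

prime⇒¬p²∣p : ∀ {p} → Prime p → ¬ (+ p * + p ∣ + p)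
prime⇒¬p²∣p {p} p-prime p²∣p = ¬prime[1] (subst Prime (ℕ∣.∣1⇒≡1 p∣1) p-prime)
  where
  instance
    p≢0 : ℕ.NonZero p
    p≢0 = prime⇒nonZero p-prime
  p∣1 : p ℕ∣.∣ 1
  p∣1 = ℕ∣.*-cancelˡ-∣ p (≡.subst₂ ℕ∣._∣_ (abs-* (+ p) (+ p)) (sym (ℕ.*-identityʳ p)) p²∣p)

fPoly-shiftedBinomial-at-0 : ∀ n' p e D →
  (-[1+ 0 ] + + 9 * e) ^ suc n' + + 9 * D * -[1+ 0 ] ^ n' ≡ + p →
  coeff (fPoly (suc n') (shiftedBinomial n' e D)) 0 ≡ + p
fPoly-shiftedBinomial-at-0 n' p e D constant-term = trans (coeff-fPoly-shiftedBinomial n' e D 0)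
  (trans (cong₂ (λ u v → u + + 9 * D * v) (coeff-lin-^P-zero _ (suc n')) (coeff-lin-^P-zero -[1+ 0 ] n')) constant-term)

shiftedBinomial-eisenstein : ∀ n' p e D → Prime p →
  + p Signed.∣ -[1+ 0 ] + + 9 * e → + p Signed.∣ D →
  coeff (fPoly (suc n') (shiftedBinomial n' e D)) 0 ≡ + p →
  IsEisenstein (+ p) (suc n') (fPoly (suc n') (shiftedBinomial n' e D))
shiftedBinomial-eisenstein n' p e D p-prime p∣root p∣D f[0]≡p =
    expansion-monic -[1+ 0 ] (suc n') (λ i → (+ 9) ^ suc (toℕ i) * shiftedBinomial n' e D i)
  , p∣lower
  , λ p²∣f[0] → prime⇒¬p²∣p p-prime (subst (+ p * + p ∣_) f[0]≡p p²∣f[0])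
  where
  p∣lower : ∀ j → j < suc n' → + p ∣ coeff (fPoly (suc n') (shiftedBinomial n' e D)) j
  p∣lower j j<n = Signed.∣⇒∣ᵤ (subst (+ p Signed.∣_) (sym (coeff-fPoly-shiftedBinomial n' e D j))
    (∣m∣n⇒∣m+n (∣coeff-lin-^P _ (suc n') j p∣root j<n) (∣m⇒∣m*n _ (∣n⇒∣m*n (+ 9) p∣D))))

root⇒algebraicInteger : ∀ {c ℓ} (R : CommutativeRing c ℓ) → NineCancellable R → ∀ n b β →
  CommutativeRing._≈_ R
    (evalR R (fPoly n b) (CommutativeRing._+_ R (CommutativeRing.1# R) (CommutativeRing._*_ R (ℕ→R R 9) β)))
    (CommutativeRing.0# R) →
  IsAlgebraicInteger R β
root⇒algebraicInteger R nine-cancel n b β root =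
  n , expansion (lin (+ 0)) n b , expansion-monic (+ 0) n b ,
  ^-cancel nine-cancel n (evalR R (expansion (lin (+ 0)) n b) β) (R.trans (R.sym (fPoly-at-1+9y n b β)) root)
  where
  module R = CommutativeRing R
  open Evaluation R using (^-cancel; fPoly-at-1+9y)

lemma5p1 : (n p : ℕ) → n ≥ 1 → Prime p → (+ 9) ∣ ((+ p) - (-[1+ 0 ] ^ n)) →
    Σ (Fin n → ℤ) λ b →
      coeff (fPoly n b) 0 ≡ + p
      × IsEisenstein (+ p) n (fPoly n b)
      × (∀ (R : CommutativeRing 0ℓ 0ℓ) → NineCancellable R →
           (β : CommutativeRing.Carrier R) →
           CommutativeRing._≈_ R
             (evalR R (fPoly n b) (CommutativeRing._+_ R (CommutativeRing.1# R)
                                     (CommutativeRing._*_ R (ℕ→R R 9) β)))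
             (CommutativeRing.0# R) →
           IsAlgebraicInteger R β)
lemma5p1 zero     _ ()  _       _
lemma5p1 (suc n') p _ p-prime 9∣p-s =
  let e , D , p∣root , p∣D , constant-term = eisensteinParameters n' p (Signed.∣ᵤ⇒∣ 9∣p-s)
      f[0]≡p = fPoly-shiftedBinomial-at-0 n' p e D constant-term
  in  shiftedBinomial n' e D
    , f[0]≡p
    , shiftedBinomial-eisenstein n' p e D p-prime p∣root p∣D f[0]≡p
    , λ R nine-cancel β → root⇒algebraicInteger R nine-cancel (suc n') (shiftedBinomial n' e D) β
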